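{- For all positive integers $m,n$, $$\sum_{k=1}^n \binom{2n}{n-k} k^{1+2m} = \frac{1}{2}\binom{2n}{n} \sum_{\ell=0}^m (-1)^\ell\, \langle n\rangle_\ell\, \langle n\rangle_{\ell+1}\, \sigma_{m,\ell}(n).$$
   Context: Falling factorial: $\langle x\rangle_0=1$ and $\langle x\rangle_j = x(x-1)\cdots(x-j+1)$ for positive integers $j$. For nonnegative integers $\ell\le m$ and an indeterminate $y$, $\sigma_{m,\ell}(y)$ denotes the coefficient of $T^{m-\ell}$ in the formal power series $\prod_{j=0}^{\ell} \frac{1}{1-T(y-j)^2}$; equivalently $\sigma_{m,\ell}(y)=\sum_{0\le k_1\le\cdots\le k_{m-\ell}\le \ell}\prod_{i=1}^{m-\ell}(y-k_i)^2$. -}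

module Defs where

open import Data.Nat as ℕ using (ℕ; zero; suc; _∸_)
open import Data.Nat.Combinatorics using (_C_)
open import Data.Integer as ℤ using (ℤ; +_; _-_; _*_; _+_)
open import Data.List using (foldr; applyUpTo)

-- Σ_{i=a}^{b} f i over integers (empty if b < a)
sumFT : ℕ → ℕ → (ℕ → ℤ) → ℤ
sumFT a b f = foldr _+_ (+ 0) (applyUpTo (λ i → f (a ℕ.+ i)) (suc b ∸ a))

_^ℤ_ : ℤ → ℕ → ℤ
x ^ℤ zero = + 1
x ^ℤ suc k = x * (x ^ℤ k)

falling : ℤ → ℕ → ℤ
falling x zero = + 1
falling x (suc j) = falling x j * (x - + j)

-- coeff y ℓ r = coefficient of T^r in ∏_{j=0}^{ℓ} 1/(1 - T (y-j)^2),
-- computed by multiplying in the geometric series factors one at a time: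
-- ∏_{j=0}^{ℓ} = (∏_{j=0}^{ℓ-1}) · Σ_i ((y-ℓ)^2)^i T^i.
coeff : ℤ → ℕ → ℕ → ℤ
coeff y zero r = (y * y) ^ℤ r
coeff y (suc ℓ) r =
  sumFT 0 r (λ i → ((y - + suc ℓ) * (y - + suc ℓ)) ^ℤ i * coeff y ℓ (r ∸ i))

σ : ℕ → ℕ → ℤ → ℤ
σ m ℓ y = coeff y ℓ (m ∸ ℓ)

sgn : ℕ → ℤ
sgn ℓ = (ℤ.- (+ 1)) ^ℤ ℓ

lhs : ℕ → ℕ → ℤ
lhs m n = sumFT 1 n (λ k → + ((2 ℕ.* n) C (n ∸ k)) * ((+ k) ^ℤ (1 ℕ.+ 2 ℕ.* m)))

rhsSum : ℕ → ℕ → ℤ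
rhsSum m n = sumFT 0 m (λ ℓ → sgn ℓ * falling (+ n) ℓ * falling (+ n) (suc ℓ) * σ m ℓ (+ n))

-- Newton interpolation of t ↦ t^m at the nodes x_j = (n - j)² reads
-- t^m = Σ_ℓ σ_{m,ℓ}(n) ∏_{j<ℓ} (t - x_j): the generating product defining σ_{m,ℓ}(n) makes it
-- the complete homogeneous polynomial h_{m-ℓ}(x_0, …, x_ℓ), i.e. the divided difference of t^m.
-- Substituting t = k² and summing against k C(2n, n-k) reduces the theorem to the moments
-- G(n,ℓ) = Σ_{k=1}^{n} C(2n, n-k) k ∏_{j<ℓ} (k² - (n-j)²). In G(n+1, ℓ+1) the term k = n + 1
-- vanishes and C(2n+2, n+1-k) (k² - (n+1)²) = -(2n+2)(2n+1) C(2n, n-k), so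
-- G(n+1, ℓ+1) = -(2n+2)(2n+1) G(n, ℓ); together with the telescoping sum 2 G(n,0) = n C(2n,n)
-- this gives 2 G(n,ℓ) = (-1)^ℓ C(2n,n) ⟨n⟩_ℓ ⟨n⟩_{ℓ+1}.

module Submission where

open import Defs

module OddPowerBinomialSums where

  open import Data.Fin.Base using (Fin; toℕ)
  open import Data.Fin.Properties using (opposite-prop; toℕ<n; toℕ-inject₁; toℕ-fromℕ)
  import Data.Fin.Permutation as Permutation
  open import Data.Integer.Base using (ℤ; +_; 0ℤ; 1ℤ; -1ℤ; _+_; _-_; _*_; -_)
  import Data.Integer.Properties as ℤ
  open import Algebra.Properties.CommutativeSemigroup ℤ.*-commutativeSemigroup using (x∙yz≈y∙xz)
  open import Algebra.Properties.Semiring.Sum ℤ.+-*-semiring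
    using (sum-syntax; sum-cong-≗; sum-init-last; *-distribˡ-sum; ∑-comm; ∑-permute)
  open import Data.Integer.Tactic.RingSolver using (solve-∀)
  open import Data.List.Base using (foldr; applyUpTo)
  open import Data.Nat.Base as ℕ using (ℕ; zero; suc; _∸_)
  import Data.Nat.Properties as ℕ
  open import Data.Nat.Combinatorics using (_C_; nC1≡n; nCk+nC[k+1]≡[n+1]C[k+1])
  open import Data.Rational.Base as ℚ using (_/_; toℚᵘ)
  open import Data.Rational.Properties using (toℚᵘ-injective; toℚᵘ-fromℚᵘ; toℚᵘ-homo-*)
  import Data.Rational.Unnormalised.Base as ℚᵘ
  import Data.Rational.Unnormalised.Properties as ℚᵘ
  open import Function.Base using (_∘_)
  open import Relation.Binary.PropositionalEquality
  open ≡-Reasoning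

  foldr-applyUpTo : ∀ n (f : ℕ → ℤ) → foldr _+_ 0ℤ (applyUpTo f n) ≡ ∑[ i < n ] f (toℕ i)
  foldr-applyUpTo zero    f = refl
  foldr-applyUpTo (suc n) f = cong (λ s → f 0 + s) (foldr-applyUpTo n (f ∘ suc))

  ∑-snoc : ∀ n (f : ℕ → ℤ) → ∑[ i < suc n ] f (toℕ i) ≡ ∑[ i < n ] f (toℕ i) + f n
  ∑-snoc n f = trans (sum-init-last {n} (f ∘ toℕ))
    (cong₂ _+_ (sum-cong-≗ {n} (cong f ∘ toℕ-inject₁)) (cong f (toℕ-fromℕ n)))

  ∑-reverse : ∀ n (f : ℕ → ℤ) → ∑[ i < n ] f (toℕ i) ≡ ∑[ i < n ] f (n ∸ suc (toℕ i))
  ∑-reverse n f =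
    trans (∑-permute {n} {n} (f ∘ toℕ) Permutation.reverse) (sum-cong-≗ {n} (cong f ∘ opposite-prop))

  ∑-∑-exchange : ∀ {n L} (w : Fin n → ℤ) (c : Fin L → ℤ) (g : Fin L → Fin n → ℤ) →
    ∑[ a < n ] (w a * ∑[ ℓ < L ] (c ℓ * g ℓ a)) ≡ ∑[ ℓ < L ] (c ℓ * ∑[ a < n ] (w a * g ℓ a))
  ∑-∑-exchange {n} {L} w c g = begin
    ∑[ a < n ] (w a * ∑[ ℓ < L ] (c ℓ * g ℓ a))
      ≡⟨ sum-cong-≗ {n} (λ a → *-distribˡ-sum {L} (w a) _) ⟩
    ∑[ a < n ] ∑[ ℓ < L ] (w a * (c ℓ * g ℓ a))
      ≡⟨ ∑-comm {n} {L} _ ⟩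
    ∑[ ℓ < L ] ∑[ a < n ] (w a * (c ℓ * g ℓ a))
      ≡⟨ sum-cong-≗ {L} (λ ℓ → sum-cong-≗ {n} (λ a → x∙yz≈y∙xz (w a) (c ℓ) _)) ⟩
    ∑[ ℓ < L ] ∑[ a < n ] (c ℓ * (w a * g ℓ a))
      ≡⟨ sum-cong-≗ {L} (λ ℓ → *-distribˡ-sum {n} (c ℓ) _) ⟨
    ∑[ ℓ < L ] (c ℓ * ∑[ a < n ] (w a * g ℓ a))  ∎

  C-zero : ∀ n → n C 0 ≡ 1
  C-zero zero    = refl
  C-zero (suc n) = refl

  C-absorption : ∀ n k → suc k ℕ.* (suc n C suc k) ≡ suc n ℕ.* (n C k)
  C-absorption n zero = begin
    1 ℕ.* (suc n C 1)  ≡⟨ ℕ.*-identityˡ _ ⟩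
    suc n C 1          ≡⟨ nC1≡n (suc n) ⟩
    suc n              ≡⟨ ℕ.*-identityʳ (suc n) ⟨
    suc n ℕ.* 1        ≡⟨ cong (suc n ℕ.*_) (C-zero n) ⟨
    suc n ℕ.* (n C 0)  ∎
  C-absorption zero    (suc k) = ℕ.*-zeroʳ (suc (suc k))
  C-absorption (suc n) (suc k) = begin
    suc (suc k) ℕ.* (suc (suc n) C suc (suc k))
      ≡⟨ cong (suc (suc k) ℕ.*_) (nCk+nC[k+1]≡[n+1]C[k+1] (suc n) (suc k)) ⟨
    suc (suc k) ℕ.* (X ℕ.+ Y)
      ≡⟨ trans (ℕ.*-distribˡ-+ (suc (suc k)) X Y) (ℕ.+-assoc X (suc k ℕ.* X) _) ⟩
    X ℕ.+ (suc k ℕ.* X ℕ.+ suc (suc k) ℕ.* Y)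
      ≡⟨ cong (X ℕ.+_) (cong₂ ℕ._+_ (C-absorption n k) (C-absorption n (suc k))) ⟩
    X ℕ.+ (suc n ℕ.* (n C k) ℕ.+ suc n ℕ.* (n C suc k))
      ≡⟨ cong (X ℕ.+_) (trans (sym (ℕ.*-distribˡ-+ (suc n) (n C k) (n C suc k)))
                              (cong (suc n ℕ.*_) (nCk+nC[k+1]≡[n+1]C[k+1] n k))) ⟩
    suc (suc n) ℕ.* X  ∎
    where
    X = suc n C suc k
    Y = suc n C suc (suc k)

  C-absorptionℤ : ∀ n k → + suc k * + (suc n C suc k) ≡ + suc n * + (n C k)
  C-absorptionℤ n k = begin
    + suc k * + (suc n C suc k)    ≡⟨ ℤ.pos-* (suc k) _ ⟨
    + (suc k ℕ.* (suc n C suc k))  ≡⟨ cong +_ (C-absorption n k) ⟩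
    + (suc n ℕ.* (n C k))          ≡⟨ ℤ.pos-* (suc n) _ ⟩
    + suc n * + (n C k)            ∎

  C-absorption-compl : ∀ n k → (+ suc n - + k) * + (suc n C k) ≡ + suc n * + (n C k)
  C-absorption-compl n zero rewrite C-zero n = lemma (+ suc n)
    where
    lemma : ∀ x → (x - + 0) * + 1 ≡ x * + 1
    lemma = solve-∀
  C-absorption-compl n (suc k) = begin
    (+ suc n - + suc k) * X
      ≡⟨ lemma (+ suc n) (+ suc k) X ⟩
    + suc n * X - + suc k * X
      ≡⟨ cong₂ (λ u v → + suc n * u - v) pascal (C-absorptionℤ n k) ⟩
    + suc n * (+ (n C k) + + (n C suc k)) - + suc n * + (n C k)
      ≡⟨ lemma′ (+ suc n) (+ (n C k)) (+ (n C suc k)) ⟩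
    + suc n * + (n C suc k)  ∎
    where
    X = + (suc n C suc k)
    pascal : X ≡ + (n C k) + + (n C suc k)
    pascal = trans (cong +_ (sym (nCk+nC[k+1]≡[n+1]C[k+1] n k))) (ℤ.pos-+ (n C k) _)
    lemma : ∀ N K X → (N - K) * X ≡ N * X - K * X
    lemma = solve-∀
    lemma′ : ∀ N A B → N * (A + B) - N * A ≡ N * B
    lemma′ = solve-∀

  C-absorption₂ : ∀ N a →
    + (suc (suc N) C suc a) * (+ suc a * (+ suc N - + a)) ≡ + suc (suc N) * (+ suc N * + (N C a))
  C-absorption₂ N a = begin
    X * (+ suc a * (+ suc N - + a))                 ≡⟨ lemma X (+ suc a) (+ suc N - + a) ⟩
    (+ suc a * X) * (+ suc N - + a)                 ≡⟨ cong (_* (+ suc N - + a)) (C-absorptionℤ (suc N) a) ⟩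
    + suc (suc N) * Y * (+ suc N - + a)             ≡⟨ ℤ.*-assoc (+ suc (suc N)) Y _ ⟩
    + suc (suc N) * (Y * (+ suc N - + a))           ≡⟨ cong (+ suc (suc N) *_) (ℤ.*-comm Y _) ⟩
    + suc (suc N) * ((+ suc N - + a) * Y)           ≡⟨ cong (+ suc (suc N) *_) (C-absorption-compl N a) ⟩
    + suc (suc N) * (+ suc N * + (N C a))           ∎
    where
    X = + (suc (suc N) C suc a)
    Y = + (suc N C a)
    lemma : ∀ X A D → X * (A * D) ≡ (A * X) * D
    lemma = solve-∀

  -- For M = N + 1, (M - 2a) C(M,a) = M (C(N,a) - C(N,a-1)), so the partial sums telescope.
  ∑-C-telescope : ∀ N s →
    ∑[ a < suc s ] (+ (suc N C toℕ a) * (+ suc N - + 2 * + toℕ a)) ≡ + suc N * + (N C s)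
  ∑-C-telescope N zero rewrite C-zero N = lemma (+ suc N)
    where
    lemma : ∀ x → + 1 * (x - + 2 * + 0) + + 0 ≡ x * + 1
    lemma = solve-∀
  ∑-C-telescope N (suc s) = begin
    ∑[ a < suc (suc s) ] f (toℕ a)                    ≡⟨ ∑-snoc (suc s) f ⟩
    ∑[ a < suc s ] f (toℕ a) + f (suc s)               ≡⟨ cong (_+ f (suc s)) (∑-C-telescope N s) ⟩
    + suc N * + (N C s) + f (suc s)
      ≡⟨ step (+ suc N) (+ suc s) X _ _ (C-absorptionℤ N s) (C-absorption-compl N (suc s)) ⟩
    + suc N * + (N C suc s)                            ∎
    where
    f : ℕ → ℤ
    f a = + (suc N C a) * (+ suc N - + 2 * + a)
    X = + (suc N C suc s)
    step : ∀ M K X A B → K * X ≡ M * A → (M - K) * X ≡ M * B → M * A + X * (M - + 2 * K) ≡ M * B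
    step M K X A B absorb compl = begin
      M * A + X * (M - + 2 * K)   ≡⟨ cong (_+ X * (M - + 2 * K)) absorb ⟨
      K * X + X * (M - + 2 * K)   ≡⟨ ring K X M ⟩
      (M - K) * X                 ≡⟨ compl ⟩
      M * B                       ∎
      where
      ring : ∀ K X M → K * X + X * (M - + 2 * K) ≡ (M - K) * X
      ring = solve-∀

  [1+i]-[1+j]≡i-j : ∀ i j → (1ℤ + i) - (1ℤ + j) ≡ i - j
  [1+i]-[1+j]≡i-j = solve-∀

  newtonBasis : (ℕ → ℤ) → ℤ → ℕ → ℤ
  newtonBasis x t zero    = 1ℤ
  newtonBasis x t (suc ℓ) = newtonBasis x t ℓ * (t - x ℓ)

  newtonBasis-cong : ∀ {x y} → (∀ j → x j ≡ y j) → ∀ t ℓ → newtonBasis x t ℓ ≡ newtonBasis y t ℓ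
  newtonBasis-cong x≗y t zero    = refl
  newtonBasis-cong x≗y t (suc ℓ) = cong₂ (λ b u → b * (t - u)) (newtonBasis-cong x≗y t ℓ) (x≗y ℓ)

  newtonBasis-suc : ∀ x t ℓ → newtonBasis x t (suc ℓ) ≡ (t - x 0) * newtonBasis (x ∘ suc) t ℓ
  newtonBasis-suc x t zero    = ℤ.*-comm 1ℤ (t - x 0)
  newtonBasis-suc x t (suc ℓ) =
    trans (cong (_* (t - x (suc ℓ))) (newtonBasis-suc x t ℓ)) (ℤ.*-assoc (t - x 0) _ _)

  newtonBasis-at-x₀ : ∀ x ℓ → newtonBasis x (x 0) (suc ℓ) ≡ 0ℤ
  newtonBasis-at-x₀ x ℓ =
    trans (newtonBasis-suc x (x 0) ℓ) (cong (_* newtonBasis (x ∘ suc) (x 0) ℓ) (ℤ.+-inverseʳ (x 0)))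

  -- The hypotheses characterise h ℓ r as the complete homogeneous symmetric
  -- polynomial of degree r in x 0, …, x ℓ.
  module Newton (x : ℕ → ℤ) (h : ℕ → ℕ → ℤ)
                (h-zero : ∀ ℓ → h ℓ 0 ≡ 1ℤ)
                (h₀-suc : ∀ r → h 0 (suc r) ≡ x 0 * h 0 r)
                (h-suc : ∀ ℓ r → h (suc ℓ) (suc r) ≡ h ℓ (suc r) + x (suc ℓ) * h (suc ℓ) r)
                where

    private
      hPrev : ℕ → ℕ → ℤ
      hPrev zero    r = 0ℤ
      hPrev (suc ℓ) r = h ℓ r

      h-step : ∀ ℓ r → h ℓ (suc r) ≡ hPrev ℓ (suc r) + x ℓ * h ℓ r
      h-step zero    r = trans (h₀-suc r) (sym (ℤ.+-identityˡ _))
      h-step (suc ℓ) r = h-suc ℓ r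

    module _ (t : ℤ) where

      private
        N : ℕ → ℤ
        N = newtonBasis x t

        newtonFrom : ℕ → ℕ → ℤ
        newtonFrom s zero    = h s 0 * N s
        newtonFrom s (suc m) = h s (suc m) * N s + newtonFrom (suc s) m

        newtonFrom-suc : ∀ m s → newtonFrom s (suc m) ≡ t * newtonFrom s m + hPrev s (suc m) * N s
        newtonFrom-suc zero s = begin
          h s 1 * N s + h (suc s) 0 * (N s * (t - x s))
            ≡⟨ cong₂ (λ u v → u * N s + v * (N s * (t - x s))) (h-step s 0) (h-zero (suc s)) ⟩
          (hPrev s 1 + x s * h s 0) * N s + 1ℤ * (N s * (t - x s))
            ≡⟨ cong (λ u → (hPrev s 1 + x s * u) * N s + 1ℤ * (N s * (t - x s))) (h-zero s) ⟩
          (hPrev s 1 + x s * 1ℤ) * N s + 1ℤ * (N s * (t - x s))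
            ≡⟨ lemma (hPrev s 1) (x s) (N s) t ⟩
          t * (1ℤ * N s) + hPrev s 1 * N s
            ≡⟨ cong (λ u → t * (u * N s) + hPrev s 1 * N s) (h-zero s) ⟨
          t * (h s 0 * N s) + hPrev s 1 * N s  ∎
          where
          lemma : ∀ p y n t → (p + y * 1ℤ) * n + 1ℤ * (n * (t - y)) ≡ t * (1ℤ * n) + p * n
          lemma = solve-∀
        newtonFrom-suc (suc m) s = begin
          h s (suc (suc m)) * N s + newtonFrom (suc s) (suc m)
            ≡⟨ cong₂ (λ u v → u * N s + v) (h-step s (suc m)) (newtonFrom-suc m (suc s)) ⟩
          (hPrev s (suc (suc m)) + x s * h s (suc m)) * N s
            + (t * newtonFrom (suc s) m + h s (suc m) * (N s * (t - x s)))
            ≡⟨ lemma (hPrev s (suc (suc m))) (x s) (h s (suc m)) (N s) t (newtonFrom (suc s) m) ⟩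
          t * (h s (suc m) * N s + newtonFrom (suc s) m) + hPrev s (suc (suc m)) * N s  ∎
          where
          lemma : ∀ p y a n t u → (p + y * a) * n + (t * u + a * (n * (t - y))) ≡ t * (a * n + u) + p * n
          lemma = solve-∀

        pow≡newtonFrom₀ : ∀ m → t ^ℤ m ≡ newtonFrom 0 m
        pow≡newtonFrom₀ zero    = sym (cong (_* 1ℤ) (h-zero 0))
        pow≡newtonFrom₀ (suc m) = begin
          t * t ^ℤ m                ≡⟨ cong (t *_) (pow≡newtonFrom₀ m) ⟩
          t * newtonFrom 0 m        ≡⟨ ℤ.+-identityʳ _ ⟨
          t * newtonFrom 0 m + 0ℤ   ≡⟨ newtonFrom-suc m 0 ⟨
          newtonFrom 0 (suc m)      ∎

        newtonFrom≡∑ : ∀ m s →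
          newtonFrom s m ≡ ∑[ ℓ < suc m ] (h (toℕ ℓ ℕ.+ s) (m ∸ toℕ ℓ) * N (toℕ ℓ ℕ.+ s))
        newtonFrom≡∑ zero    s = sym (ℤ.+-identityʳ _)
        newtonFrom≡∑ (suc m) s = cong (λ u → h s (suc m) * N s + u) (trans (newtonFrom≡∑ m (suc s))
          (sum-cong-≗ {suc m} (λ ℓ → cong (λ k → h k (m ∸ toℕ ℓ) * N k) (ℕ.+-suc (toℕ ℓ) s))))

      newton : ∀ m → t ^ℤ m ≡ ∑[ ℓ < suc m ] (h (toℕ ℓ) (m ∸ toℕ ℓ) * newtonBasis x t (toℕ ℓ))
      newton m = trans (pow≡newtonFrom₀ m) (trans (newtonFrom≡∑ m 0)
        (sum-cong-≗ {suc m} (λ ℓ → cong (λ k → h k (m ∸ toℕ ℓ) * N k) (ℕ.+-identityʳ (toℕ ℓ)))))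

  nodes : ℤ → ℕ → ℤ
  nodes y j = (y - + j) * (y - + j)

  nodes-suc : ∀ n j → nodes (+ suc n) (suc j) ≡ nodes (+ n) j
  nodes-suc n j = cong (λ u → u * u) ([1+i]-[1+j]≡i-j (+ n) (+ j))

  coeff-zero : ∀ y ℓ → coeff y ℓ 0 ≡ 1ℤ
  coeff-zero y zero    = refl
  coeff-zero y (suc ℓ) = trans (ℤ.+-identityʳ _) (trans (ℤ.*-identityˡ _) (coeff-zero y ℓ))

  coeff₀-suc : ∀ y r → coeff y 0 (suc r) ≡ nodes y 0 * coeff y 0 r
  coeff₀-suc y r = cong (λ u → u * u * (y * y) ^ℤ r) (sym (ℤ.+-identityʳ y))

  coeff-suc : ∀ y ℓ r → coeff y (suc ℓ) (suc r) ≡ coeff y ℓ (suc r) + nodes y (suc ℓ) * coeff y (suc ℓ) r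
  coeff-suc y ℓ r = cong₂ _+_ (ℤ.*-identityˡ (coeff y ℓ (suc r))) (begin
    foldr _+_ 0ℤ (applyUpTo (λ i → X * X ^ℤ i * coeff y ℓ (r ∸ i)) (suc r))
      ≡⟨ foldr-applyUpTo (suc r) (λ i → X * X ^ℤ i * coeff y ℓ (r ∸ i)) ⟩
    ∑[ i < suc r ] (X * X ^ℤ toℕ i * coeff y ℓ (r ∸ toℕ i))
      ≡⟨ sum-cong-≗ {suc r} (λ i → ℤ.*-assoc X (X ^ℤ toℕ i) (coeff y ℓ (r ∸ toℕ i))) ⟩
    ∑[ i < suc r ] (X * (X ^ℤ toℕ i * coeff y ℓ (r ∸ toℕ i)))
      ≡⟨ *-distribˡ-sum {suc r} X (λ i → X ^ℤ toℕ i * coeff y ℓ (r ∸ toℕ i)) ⟨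
    X * ∑[ i < suc r ] (X ^ℤ toℕ i * coeff y ℓ (r ∸ toℕ i))
      ≡⟨ cong (X *_) (foldr-applyUpTo (suc r) (λ i → X ^ℤ i * coeff y ℓ (r ∸ i))) ⟨
    X * coeff y (suc ℓ) r  ∎)
    where
    X = nodes y (suc ℓ)

  ^ℤ-double : ∀ x m → x ^ℤ (2 ℕ.* m) ≡ (x * x) ^ℤ m
  ^ℤ-double x zero    = refl
  ^ℤ-double x (suc m) = begin
    x ^ℤ (2 ℕ.* suc m)            ≡⟨ cong (x ^ℤ_) (ℕ.*-suc 2 m) ⟩
    x * (x * x ^ℤ (2 ℕ.* m))      ≡⟨ ℤ.*-assoc x x _ ⟨
    x * x * x ^ℤ (2 ℕ.* m)        ≡⟨ cong (x * x *_) (^ℤ-double x m) ⟩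
    (x * x) ^ℤ suc m              ∎

  odd-power-newton : ∀ y m k →
    k ^ℤ suc (2 ℕ.* m) ≡ ∑[ ℓ < suc m ] (σ m (toℕ ℓ) y * (k * newtonBasis (nodes y) (k * k) (toℕ ℓ)))
  odd-power-newton y m k = begin
    k * k ^ℤ (2 ℕ.* m)
      ≡⟨ cong (k *_) (trans (^ℤ-double k m) (newton (k * k) m)) ⟩
    k * ∑[ ℓ < suc m ] (σ m (toℕ ℓ) y * newtonBasis (nodes y) (k * k) (toℕ ℓ))
      ≡⟨ *-distribˡ-sum {suc m} k (λ ℓ → σ m (toℕ ℓ) y * newtonBasis (nodes y) (k * k) (toℕ ℓ)) ⟩
    ∑[ ℓ < suc m ] (k * (σ m (toℕ ℓ) y * newtonBasis (nodes y) (k * k) (toℕ ℓ)))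
      ≡⟨ sum-cong-≗ {suc m} (λ ℓ → x∙yz≈y∙xz k (σ m (toℕ ℓ) y) (newtonBasis (nodes y) (k * k) (toℕ ℓ))) ⟩
    ∑[ ℓ < suc m ] (σ m (toℕ ℓ) y * (k * newtonBasis (nodes y) (k * k) (toℕ ℓ)))  ∎
    where open Newton (nodes y) (coeff y) (coeff-zero y) (coeff₀-suc y) (coeff-suc y)

  -- (n - a)² - (n + 1)² = -(a + 1)(2n + 1 - a), and C-absorption₂ absorbs both factors.
  C-node-step : ∀ n a →
    + (suc (suc (2 ℕ.* n)) C suc a) * (nodes (+ n) a - nodes (+ suc n) 0)
      ≡ - (+ suc (suc (2 ℕ.* n)) * + suc (2 ℕ.* n)) * + ((2 ℕ.* n) C a)
  C-node-step n a = begin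
    X * (nodes (+ n) a - nodes (+ suc n) 0)           ≡⟨ lemma X (+ n) (+ a) ⟩
    - (X * (+ suc a * (+ suc (2 ℕ.* n) - + a)))       ≡⟨ cong -_ (C-absorption₂ (2 ℕ.* n) a) ⟩
    - (+ suc (suc (2 ℕ.* n)) * (+ suc (2 ℕ.* n) * Y)) ≡⟨ lemma′ (+ suc (suc (2 ℕ.* n))) (+ suc (2 ℕ.* n)) Y ⟩
    - (+ suc (suc (2 ℕ.* n)) * + suc (2 ℕ.* n)) * Y   ∎
    where
    X = + (suc (suc (2 ℕ.* n)) C suc a)
    Y = + ((2 ℕ.* n) C a)
    lemma : ∀ c n a → c * ((n - a) * (n - a) - ((1ℤ + n) - 0ℤ) * ((1ℤ + n) - 0ℤ))
                        ≡ - (c * ((1ℤ + a) * ((1ℤ + (n + (n + 0ℤ))) - a)))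
    lemma = solve-∀
    lemma′ : ∀ p q y → - (p * (q * y)) ≡ - (p * q) * y
    lemma′ = solve-∀

  -- binomialMoment n f = Σ_{k=1}^{n} C(2n, n-k) f(k), indexed by a = n - k.
  binomialMoment : ℕ → (ℤ → ℤ) → ℤ
  binomialMoment n f = ∑[ a < n ] (+ ((2 ℕ.* n) C toℕ a) * f (+ n - + toℕ a))

  binomialMoment-suc : ∀ n f →
    binomialMoment (suc n) f ≡ ∑[ a < suc n ] (+ (suc (suc (2 ℕ.* n)) C toℕ a) * f (+ suc n - + toℕ a))
  binomialMoment-suc n f =
    sum-cong-≗ {suc n} (λ a → cong (λ M → + (M C toℕ a) * f (+ suc n - + toℕ a)) (ℕ.*-suc 2 n))

  lhs≡binomialMoment : ∀ m n → lhs m n ≡ binomialMoment n (λ k → k ^ℤ suc (2 ℕ.* m))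
  lhs≡binomialMoment m n = begin
    lhs m n                                 ≡⟨ foldr-applyUpTo n (F ∘ suc) ⟩
    ∑[ i < n ] F (suc (toℕ i))              ≡⟨ ∑-reverse n (F ∘ suc) ⟩
    ∑[ a < n ] F (suc (n ∸ suc (toℕ a)))    ≡⟨ sum-cong-≗ {n} (λ a → reflect (toℕ<n a)) ⟩
    binomialMoment n (λ k → k ^ℤ suc (2 ℕ.* m))  ∎
    where
    F : ℕ → ℤ
    F k = + ((2 ℕ.* n) C (n ∸ k)) * (+ k) ^ℤ suc (2 ℕ.* m)
    reflect : ∀ {a} → a ℕ.< n → F (suc (n ∸ suc a)) ≡ + ((2 ℕ.* n) C a) * (+ n - + a) ^ℤ suc (2 ℕ.* m)
    reflect {a} a<n = begin
      F (suc (n ∸ suc a))   ≡⟨ cong F (ℕ.+-∸-assoc 1 a<n) ⟨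
      F (n ∸ a)             ≡⟨ cong₂ (λ b k → + ((2 ℕ.* n) C b) * k ^ℤ suc (2 ℕ.* m)) (ℕ.m∸[m∸n]≡n a≤n) n∸a≡n-a ⟩
      + ((2 ℕ.* n) C a) * (+ n - + a) ^ℤ suc (2 ℕ.* m)  ∎
      where
      a≤n = ℕ.<⇒≤ a<n
      n∸a≡n-a : + (n ∸ a) ≡ + n - + a
      n∸a≡n-a = sym (trans (ℤ.m-n≡m⊖n n a) (ℤ.⊖-≥ a≤n))

  basisMoment : ℕ → ℕ → ℤ
  basisMoment n ℓ = binomialMoment n (λ k → k * newtonBasis (nodes (+ n)) (k * k) ℓ)

  binomialMoment-odd-power : ∀ m n →
    binomialMoment n (λ k → k ^ℤ suc (2 ℕ.* m)) ≡ ∑[ ℓ < suc m ] (σ m (toℕ ℓ) (+ n) * basisMoment n (toℕ ℓ))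
  binomialMoment-odd-power m n = trans
    (sum-cong-≗ {n} (λ a → cong (w a *_) (odd-power-newton (+ n) m (k a))))
    (∑-∑-exchange {n} {suc m} w (λ ℓ → σ m (toℕ ℓ) (+ n))
                                (λ ℓ a → k a * newtonBasis (nodes (+ n)) (k a * k a) (toℕ ℓ)))
    where
    w : Fin n → ℤ
    w a = + ((2 ℕ.* n) C toℕ a)
    k : Fin n → ℤ
    k a = + n - + toℕ a

  basisMoment-zero : ∀ n → + 2 * basisMoment n 0 ≡ + ((2 ℕ.* n) C n) * + n
  basisMoment-zero zero    = refl
  basisMoment-zero (suc p) = begin
    + 2 * basisMoment (suc p) 0
      ≡⟨ cong (+ 2 *_) (binomialMoment-suc p (λ k → k * 1ℤ)) ⟩
    + 2 * ∑[ a < suc p ] (+ (M C toℕ a) * ((+ suc p - + toℕ a) * 1ℤ))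
      ≡⟨ *-distribˡ-sum {suc p} (+ 2) (λ a → + (M C toℕ a) * ((+ suc p - + toℕ a) * 1ℤ)) ⟩
    ∑[ a < suc p ] (+ 2 * (+ (M C toℕ a) * ((+ suc p - + toℕ a) * 1ℤ)))
      ≡⟨ sum-cong-≗ {suc p} (λ a → lemma (+ (M C toℕ a)) (+ p) (+ toℕ a)) ⟩
    ∑[ a < suc p ] (+ (M C toℕ a) * (+ M - + 2 * + toℕ a))
      ≡⟨ ∑-C-telescope (suc (2 ℕ.* p)) p ⟩
    + M * + (suc (2 ℕ.* p) C p)
      ≡⟨ C-absorptionℤ (suc (2 ℕ.* p)) p ⟨
    + suc p * + (M C suc p)
      ≡⟨ ℤ.*-comm (+ suc p) _ ⟩
    + (M C suc p) * + suc p
      ≡⟨ cong (λ M → + (M C suc p) * + suc p) (ℕ.*-suc 2 p) ⟨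
    + ((2 ℕ.* suc p) C suc p) * + suc p  ∎
    where
    M = suc (suc (2 ℕ.* p))
    lemma : ∀ c p a → + 2 * (c * (((1ℤ + p) - a) * 1ℤ)) ≡ c * ((1ℤ + (1ℤ + (p + (p + 0ℤ)))) - + 2 * a)
    lemma = solve-∀

  basisMoment-suc : ∀ n ℓ →
    basisMoment (suc n) (suc ℓ) ≡ - (+ suc (suc (2 ℕ.* n)) * + suc (2 ℕ.* n)) * basisMoment n ℓ
  basisMoment-suc n ℓ = begin
    basisMoment (suc n) (suc ℓ)
      ≡⟨ binomialMoment-suc n T ⟩
    + (M C 0) * T (+ suc n - + 0) + ∑[ a < n ] (+ (M C suc (toℕ a)) * T (+ suc n - + suc (toℕ a)))
      ≡⟨ cong₂ _+_ first-term-vanishes (sum-cong-≗ {n} (λ a → term (toℕ a))) ⟩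
    0ℤ + ∑[ a < n ] (R * (+ ((2 ℕ.* n) C toℕ a) * T′ (+ n - + toℕ a)))
      ≡⟨ ℤ.+-identityˡ _ ⟩
    ∑[ a < n ] (R * (+ ((2 ℕ.* n) C toℕ a) * T′ (+ n - + toℕ a)))
      ≡⟨ *-distribˡ-sum {n} R (λ a → + ((2 ℕ.* n) C toℕ a) * T′ (+ n - + toℕ a)) ⟨
    R * basisMoment n ℓ  ∎
    where
    M = suc (suc (2 ℕ.* n))
    R = - (+ M * + suc (2 ℕ.* n))
    T T′ : ℤ → ℤ
    T  k = k * newtonBasis (nodes (+ suc n)) (k * k) (suc ℓ)
    T′ k = k * newtonBasis (nodes (+ n)) (k * k) ℓ

    first-term-vanishes : + (M C 0) * T (+ suc n - + 0) ≡ 0ℤ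
    first-term-vanishes = begin
      + (M C 0) * ((+ suc n - + 0) * newtonBasis (nodes (+ suc n)) (nodes (+ suc n) 0) (suc ℓ))
        ≡⟨ cong (λ b → + (M C 0) * ((+ suc n - + 0) * b)) (newtonBasis-at-x₀ (nodes (+ suc n)) ℓ) ⟩
      + (M C 0) * ((+ suc n - + 0) * 0ℤ)
        ≡⟨ cong (+ (M C 0) *_) (ℤ.*-zeroʳ (+ suc n - + 0)) ⟩
      + (M C 0) * 0ℤ
        ≡⟨ ℤ.*-zeroʳ (+ (M C 0)) ⟩
      0ℤ  ∎

    term : ∀ a → + (M C suc a) * T (+ suc n - + suc a) ≡ R * (+ ((2 ℕ.* n) C a) * T′ (+ n - + a))
    term a = begin
      X * T (+ suc n - + suc a)
        ≡⟨ cong (λ k → X * T k) ([1+i]-[1+j]≡i-j (+ n) (+ a)) ⟩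
      X * (k * newtonBasis (nodes (+ suc n)) (k * k) (suc ℓ))
        ≡⟨ cong (λ b → X * (k * b)) (newtonBasis-suc (nodes (+ suc n)) (k * k) ℓ) ⟩
      X * (k * ((k * k - nodes (+ suc n) 0) * newtonBasis (nodes (+ suc n) ∘ suc) (k * k) ℓ))
        ≡⟨ cong (λ b → X * (k * ((k * k - nodes (+ suc n) 0) * b)))
                (newtonBasis-cong (nodes-suc n) (k * k) ℓ) ⟩
      X * (k * ((k * k - nodes (+ suc n) 0) * B))
        ≡⟨ lemma X k (k * k - nodes (+ suc n) 0) B ⟩
      X * (k * k - nodes (+ suc n) 0) * (k * B)
        ≡⟨ cong (_* (k * B)) (C-node-step n a) ⟩
      R * + ((2 ℕ.* n) C a) * (k * B)
        ≡⟨ ℤ.*-assoc R (+ ((2 ℕ.* n) C a)) (k * B) ⟩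
      R * (+ ((2 ℕ.* n) C a) * T′ k)  ∎
      where
      X = + (M C suc a)
      k = + n - + a
      B = newtonBasis (nodes (+ n)) (k * k) ℓ
      lemma : ∀ x k d b → x * (k * (d * b)) ≡ x * d * (k * b)
      lemma = solve-∀

  falling-suc : ∀ x ℓ → falling (1ℤ + x) (suc ℓ) ≡ (1ℤ + x) * falling x ℓ
  falling-suc x zero    = lemma x
    where
    lemma : ∀ x → 1ℤ * ((1ℤ + x) - 0ℤ) ≡ (1ℤ + x) * 1ℤ
    lemma = solve-∀
  falling-suc x (suc ℓ) = begin
    falling (1ℤ + x) (suc ℓ) * ((1ℤ + x) - (1ℤ + + ℓ))  ≡⟨ cong₂ _*_ (falling-suc x ℓ) ([1+i]-[1+j]≡i-j x (+ ℓ)) ⟩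
    (1ℤ + x) * falling x ℓ * (x - + ℓ)                  ≡⟨ ℤ.*-assoc (1ℤ + x) _ _ ⟩
    (1ℤ + x) * falling x (suc ℓ)                        ∎

  signedFalling : ℕ → ℕ → ℤ
  signedFalling n ℓ = sgn ℓ * falling (+ n) ℓ * falling (+ n) (suc ℓ)

  signedFalling-suc : ∀ n ℓ → signedFalling (suc n) (suc ℓ) ≡ - (+ suc n * + suc n) * signedFalling n ℓ
  signedFalling-suc n ℓ = begin
    -1ℤ * sgn ℓ * falling (+ suc n) (suc ℓ) * falling (+ suc n) (suc (suc ℓ))
      ≡⟨ cong₂ (λ u v → -1ℤ * sgn ℓ * u * v) (falling-suc (+ n) ℓ) (falling-suc (+ n) (suc ℓ)) ⟩
    -1ℤ * sgn ℓ * (+ suc n * falling (+ n) ℓ) * (+ suc n * falling (+ n) (suc ℓ))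
      ≡⟨ lemma (sgn ℓ) (+ suc n) (falling (+ n) ℓ) (falling (+ n) (suc ℓ)) ⟩
    - (+ suc n * + suc n) * signedFalling n ℓ  ∎
    where
    lemma : ∀ s x f g → -1ℤ * s * (x * f) * (x * g) ≡ - (x * x) * (s * f * g)
    lemma = solve-∀

  signedFalling-zero : ∀ n → signedFalling n 0 ≡ + n
  signedFalling-zero n = lemma (+ n)
    where
    lemma : ∀ x → 1ℤ * 1ℤ * (1ℤ * (x - 0ℤ)) ≡ x
    lemma = solve-∀

  -- At x = -1, falling-suc exposes the factor 1 + (-1) = 0 of ⟨0⟩_{ℓ+2}.
  signedFalling-0-suc : ∀ ℓ → signedFalling 0 (suc ℓ) ≡ 0ℤ
  signedFalling-0-suc ℓ =
    trans (cong (s *_) (falling-suc -1ℤ (suc ℓ))) (ℤ.*-zeroʳ s)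
    where
    s = sgn (suc ℓ) * falling 0ℤ (suc ℓ)

  basisMoment-closed : ∀ n ℓ → + 2 * basisMoment n ℓ ≡ + ((2 ℕ.* n) C n) * signedFalling n ℓ
  basisMoment-closed n zero =
    trans (basisMoment-zero n) (cong (+ ((2 ℕ.* n) C n) *_) (sym (signedFalling-zero n)))
  basisMoment-closed zero (suc ℓ) = sym (cong (+ 1 *_) (signedFalling-0-suc ℓ))
  basisMoment-closed (suc n) (suc ℓ) = begin
    + 2 * basisMoment (suc n) (suc ℓ)   ≡⟨ cong (+ 2 *_) (basisMoment-suc n ℓ) ⟩
    + 2 * (R * basisMoment n ℓ)         ≡⟨ x∙yz≈y∙xz (+ 2) R (basisMoment n ℓ) ⟩
    R * (+ 2 * basisMoment n ℓ)         ≡⟨ cong (R *_) (basisMoment-closed n ℓ) ⟩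
    R * (+ ((2 ℕ.* n) C n) * w)         ≡⟨ ℤ.*-assoc R (+ ((2 ℕ.* n) C n)) w ⟨
    R * + ((2 ℕ.* n) C n) * w           ≡⟨ cong (_* w) (C-node-step n n) ⟨
    X * (nodes (+ n) n - nodes (+ suc n) 0) * w  ≡⟨ lemma X (+ n) w ⟩
    X * (- (+ suc n * + suc n) * w)     ≡⟨ cong₂ (λ M v → + (M C suc n) * v) (ℕ.*-suc 2 n) (signedFalling-suc n ℓ) ⟨
    + ((2 ℕ.* suc n) C suc n) * signedFalling (suc n) (suc ℓ)  ∎
    where
    R = - (+ suc (suc (2 ℕ.* n)) * + suc (2 ℕ.* n))
    X = + (suc (suc (2 ℕ.* n)) C suc n)
    w = signedFalling n ℓ
    lemma : ∀ x n w → x * ((n - n) * (n - n) - ((1ℤ + n) - 0ℤ) * ((1ℤ + n) - 0ℤ)) * w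
                        ≡ x * (- ((1ℤ + n) * (1ℤ + n)) * w)
    lemma = solve-∀

  2*i≡j*k⇒i/1≡½*j/1*k/1 : ∀ i j k → + 2 * i ≡ j * k → i / 1 ≡ (+ 1 / 2) ℚ.* ((j / 1) ℚ.* (k / 1))
  2*i≡j*k⇒i/1≡½*j/1*k/1 i j k 2i≡jk = toℚᵘ-injective
    (ℚᵘ.≃-trans (toℚᵘ-fromℚᵘ (ℚᵘ.mkℚᵘ i 0)) (ℚᵘ.≃-trans (ℚᵘ.*≡* cross) (ℚᵘ.≃-sym product)))
    where
    cross : i * + 2 ≡ + 1 * (j * k) * + 1
    cross = trans (ℤ.*-comm i (+ 2)) (trans 2i≡jk (lemma j k))
      where
      lemma : ∀ j k → j * k ≡ + 1 * (j * k) * + 1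
      lemma = solve-∀
    product : toℚᵘ ((+ 1 / 2) ℚ.* ((j / 1) ℚ.* (k / 1)))
                ℚᵘ.≃ ℚᵘ.mkℚᵘ (+ 1) 1 ℚᵘ.* (ℚᵘ.mkℚᵘ j 0 ℚᵘ.* ℚᵘ.mkℚᵘ k 0)
    product = ℚᵘ.≃-trans (toℚᵘ-homo-* (+ 1 / 2) ((j / 1) ℚ.* (k / 1)))
      (ℚᵘ.*-cong (toℚᵘ-fromℚᵘ (ℚᵘ.mkℚᵘ (+ 1) 1)) (ℚᵘ.≃-trans (toℚᵘ-homo-* (j / 1) (k / 1))
        (ℚᵘ.*-cong (toℚᵘ-fromℚᵘ (ℚᵘ.mkℚᵘ j 0)) (toℚᵘ-fromℚᵘ (ℚᵘ.mkℚᵘ k 0)))))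

  2*lhs≡[2n]Cn*rhsSum : ∀ m n → + 2 * lhs m n ≡ + ((2 ℕ.* n) C n) * rhsSum m n
  2*lhs≡[2n]Cn*rhsSum m n = begin
    + 2 * lhs m n
      ≡⟨ cong (+ 2 *_) (trans (lhs≡binomialMoment m n) (binomialMoment-odd-power m n)) ⟩
    + 2 * ∑[ ℓ < suc m ] (c ℓ * G ℓ)
      ≡⟨ *-distribˡ-sum {suc m} (+ 2) (λ ℓ → c ℓ * G ℓ) ⟩
    ∑[ ℓ < suc m ] (+ 2 * (c ℓ * G ℓ))
      ≡⟨ sum-cong-≗ {suc m} termwise ⟩
    ∑[ ℓ < suc m ] (Cₙ * (signedFalling n (toℕ ℓ) * c ℓ))
      ≡⟨ *-distribˡ-sum {suc m} Cₙ (λ ℓ → signedFalling n (toℕ ℓ) * c ℓ) ⟨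
    Cₙ * ∑[ ℓ < suc m ] (signedFalling n (toℕ ℓ) * c ℓ)
      ≡⟨ cong (Cₙ *_) (foldr-applyUpTo (suc m) (λ ℓ → signedFalling n ℓ * σ m ℓ (+ n))) ⟨
    Cₙ * rhsSum m n  ∎
    where
    Cₙ = + ((2 ℕ.* n) C n)
    c G : Fin (suc m) → ℤ
    c ℓ = σ m (toℕ ℓ) (+ n)
    G ℓ = basisMoment n (toℕ ℓ)
    termwise : ∀ ℓ → + 2 * (c ℓ * G ℓ) ≡ Cₙ * (signedFalling n (toℕ ℓ) * c ℓ)
    termwise ℓ = begin
      + 2 * (c ℓ * G ℓ)                 ≡⟨ x∙yz≈y∙xz (+ 2) (c ℓ) (G ℓ) ⟩
      c ℓ * (+ 2 * G ℓ)                 ≡⟨ cong (c ℓ *_) (basisMoment-closed n (toℕ ℓ)) ⟩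
      c ℓ * (Cₙ * signedFalling n (toℕ ℓ))  ≡⟨ x∙yz≈y∙xz (c ℓ) Cₙ _ ⟩
      Cₙ * (c ℓ * signedFalling n (toℕ ℓ))  ≡⟨ cong (Cₙ *_) (ℤ.*-comm (c ℓ) _) ⟩
      Cₙ * (signedFalling n (toℕ ℓ) * c ℓ)  ∎

open import Data.Nat using (ℕ; _*_; NonZero)
open import Data.Nat.Combinatorics using (_C_)
open import Data.Rational using (_/_)
open import Data.Integer using (+_)
open import Relation.Binary.PropositionalEquality using (_≡_)
open OddPowerBinomialSums using (2*lhs≡[2n]Cn*rhsSum; 2*i≡j*k⇒i/1≡½*j/1*k/1)

-- The identity also holds for m = 0 and n = 0.
theorem4 : (m n : ℕ) → .{{NonZero m}} → .{{NonZero n}} →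
    lhs m n / 1 ≡ (+ 1 / 2) Data.Rational.* ((+ ((2 * n) C n) / 1) Data.Rational.* (rhsSum m n / 1))
theorem4 m n = 2*i≡j*k⇒i/1≡½*j/1*k/1 (lhs m n) (+ ((2 * n) C n)) (rhsSum m n) (2*lhs≡[2n]Cn*rhsSum m n)
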